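{- For $n\geq 6$, the number of minimal forts for $C_{n}$ satisfies \[ \lvert\mathcal{F}_{C_{n}}\rvert = \lvert\mathcal{F}_{C_{n-2}}\rvert + \lvert\mathcal{F}_{C_{n-3}}\rvert, \] where $\lvert\mathcal{F}_{C_{3}}\rvert=3$, $\lvert\mathcal{F}_{C_{4}}\rvert=2$, and $\lvert\mathcal{F}_{C_{5}}\rvert=5$.
   Context: For a graph $G=(V,E)$, a non-empty subset $F\subseteq V$ is a fort if no vertex outside $F$ has exactly one neighbor in $F$; a fort is minimal if every proper subset is not a fort. $\mathcal{F}_{G}$ denotes the collection of all minimal forts of $G$. $C_{n}$ is the cycle graph on $n$ vertices (the path $v_1,\ldots,v_n$ plus the edge $\{v_1,v_n\}$). -}

module Defs where

open import Data.Nat using (ℕ; zero; suc; _≡ᵇ_)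
open import Data.Nat.Properties using (_≟_)
open import Data.Bool using (Bool; true; false; _∧_; _∨_)
open import Data.Fin using (Fin; toℕ)
open import Data.Fin.Subset using (Subset; _∈_; _∉_; _⊂_; ∣_∣; Nonempty; _∩_; inside; outside)
open import Data.Fin.Subset.Properties using (_∈?_; nonempty?; _⊂?_; anySubset?)
open import Data.Fin.Properties using (all?)
open import Data.Vec using (Vec; []; _∷_; tabulate)
open import Data.List using (List; []; _∷_; _++_; map; filter; length)
open import Data.Product using (_×_; _,_; ∃)
open import Relation.Nullary using (¬_; Dec; yes; no)
open import Relation.Nullary.Decidable using (_×-dec_; ¬?)
open import Relation.Binary.PropositionalEquality using (_≡_; _≢_)

Graph : ℕ → Set
Graph n = Fin n → Fin n → Bool

-- The cycle graph C_n on vertices 0,…,n-1 (v_{i+1} ↦ i): the path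
-- 0 - 1 - … - (n-1) plus the edge {0, n-1}.  (Meant for n ≥ 3.)
cycleGraph : (n : ℕ) → Graph n
cycleGraph n i j =
  (suc (toℕ i) ≡ᵇ toℕ j) ∨ (suc (toℕ j) ≡ᵇ toℕ i)
  ∨ ((toℕ i ≡ᵇ 0) ∧ (suc (toℕ j) ≡ᵇ n))
  ∨ ((toℕ j ≡ᵇ 0) ∧ (suc (toℕ i) ≡ᵇ n))

nbhd : ∀ {n} → Graph n → Fin n → Subset n
nbhd G v = tabulate (λ w → G v w)

IsFort : ∀ {n} → Graph n → Subset n → Set
IsFort {n} G F = Nonempty F × (∀ (v : Fin n) → v ∉ F → ∣ nbhd G v ∩ F ∣ ≢ 1)

IsMinimalFort : ∀ {n} → Graph n → Subset n → Set
IsMinimalFort G F = IsFort G F × (∀ F′ → F′ ⊂ F → ¬ IsFort G F′)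

isFort? : ∀ {n} (G : Graph n) (F : Subset n) → Dec (IsFort G F)
isFort? G F = nonempty? F ×-dec all? (λ v → decImp (v ∈? F) (¬? (∣ nbhd G v ∩ F ∣ ≟ 1)))
  where
  decImp : ∀ {A B : Set} → Dec A → Dec B → Dec (¬ A → B)
  decImp (yes a) _ = yes (λ na → Data.Empty.⊥-elim (na a))
    where import Data.Empty
  decImp (no na) (yes b) = yes (λ _ → b)
  decImp (no na) (no nb) = no (λ f → nb (f na))

isMinimalFort? : ∀ {n} (G : Graph n) (F : Subset n) → Dec (IsMinimalFort G F)
isMinimalFort? G F = isFort? G F ×-dec noSmaller
  where
  noSmaller : Dec (∀ F′ → F′ ⊂ F → ¬ IsFort G F′)
  noSmaller with anySubset? (λ F′ → (F′ ⊂? F) ×-dec isFort? G F′)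
  ... | yes (F′ , p , q) = no (λ h → h F′ p q)
  ... | no ¬e = yes (λ F′ p q → ¬e (F′ , p , q))

allSubsets : (n : ℕ) → List (Subset n)
allSubsets zero = [] ∷ []
allSubsets (suc n) = map (inside ∷_) (allSubsets n) ++ map (outside ∷_) (allSubsets n)

numMinimalForts : ∀ {n} → Graph n → ℕ
numMinimalForts {n} G = length (filter (isMinimalFort? G) (allSubsets n))

module Submission where

-- In C_n every vertex v has exactly the two neighbours v - 1 and v + 1, so F is a fort iff every
-- vertex outside F has both or neither of its neighbours in F.  Two consecutive vertices outside F
-- therefore push each other around the whole cycle, and the forts are exactly the sets with no two
-- consecutive vertices outside.  Such a fort is minimal iff it has no three consecutive vertices:
-- the middle one of three can be dropped, and dropping a vertex of a fort without three in a row
-- leaves two consecutive vertices outside.  Minimal forts are thus the cyclic binary words with no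
-- 00 and no 111.  They are counted by the transfer matrix on pairs of consecutive letters, and
-- every entry x_m of its m-th power satisfies x_(m+3) = x_(m+1) + x_m, which gives the recurrence;
-- the initial values are computed.

open import Defs
open import Data.Bool using (Bool; true; false; T; _∧_; _∨_; not; if_then_else_)
open import Data.Bool.Properties using (T-∧; T-∨; T-≡; ∨-zeroʳ; ∨-identityʳ)
open import Data.Empty using (⊥-elim)
open import Data.Fin using (Fin; toℕ) renaming (zero to fzero; suc to fsuc)
open import Data.Fin.Properties using (toℕ-injective; toℕ-fromℕ<; toℕ<n) renaming (_≟_ to _≟ᶠ_)
open import Data.Fin.Subset using (Subset; _∈_; _∉_; _⊆_; _⊂_; ∣_∣; _∩_; _-_; ⁅_⁆)
open import Data.Fin.Subset.Properties
  using (_∈?_; ⊆-antisym; ∣⁅x⁆∣≡1; x∈⁅y⁆⇒x≡y; x∈⁅x⁆; x∈p∩q⁺; x∈p∩q⁻; p⊂q⇒∣p∣<∣q∣;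
         x∈p∧x≢y⇒x∈p-y; x∈p⇒p-x⊂p)
open import Data.List using (List; []; _∷_; _++_; map; filter; length; applyUpTo)
open import Data.List.Properties using (filter-accept; filter-reject)
open import Data.Nat using (ℕ; zero; suc; _+_; _*_; _∸_; _≤_; _<_; _>_; _≡ᵇ_; s≤s; z≤n)
open import Data.Nat.DivMod
  using (_%_; _mod_; m%n<n; m<n⇒m%n≡m; n%n≡0; m%n%n≡m%n; %-distribˡ-+; [m+kn]%n≡m%n)
open import Data.Nat.Properties
  using (+-comm; +-assoc; +-identityʳ; ≡ᵇ⇒≡; ≡⇒≡ᵇ; m≤n⇒m<n∨m≡n; >⇒≢; m≤n⇒∃[o]m+o≡n)
open import Data.Nat.Tactic.RingSolver using (solve-∀)
open import Data.Product using (_×_; _,_; proj₁; proj₂; ∃)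
open import Data.Sum using (_⊎_; inj₁; inj₂)
import Data.Sum as Sum
open import Data.Sum.Function.Propositional using (_⊎-⇔_)
open import Data.Unit using (tt)
open import Data.Vec using (Vec; []; _∷_; toList; lookup)
open import Data.Vec.Properties using ([]=⇒lookup; lookup⇒[]=; lookup∘tabulate)
open import Function using (id; _∘_)
open import Function.Bundles using (_⇔_; mk⇔; Equivalence)
open import Function.Properties.Equivalence using () renaming (trans to ⇔-trans; sym to ⇔-sym)
open import Level using (Level)
open import Relation.Nullary using (¬_; yes; no)
open import Relation.Unary using (Pred; Decidable)
open import Relation.Binary.PropositionalEquality

open Equivalence using (to; from)

count : {A : Set} → (A → Bool) → List A → ℕ
count p [] = 0
count p (x ∷ xs) = if p x then suc (count p xs) else count p xs

count-++ : {A : Set} (p : A → Bool) (xs ys : List A) → count p (xs ++ ys) ≡ count p xs + count p ys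
count-++ p [] ys = refl
count-++ p (x ∷ xs) ys with p x
... | true  = cong suc (count-++ p xs ys)
... | false = count-++ p xs ys

count-map : {A B : Set} (p : B → Bool) (f : A → B) (xs : List A) → count p (map f xs) ≡ count (p ∘ f) xs
count-map p f [] = refl
count-map p f (x ∷ xs) with p (f x)
... | true  = cong suc (count-map p f xs)
... | false = count-map p f xs

count-∧ : {A : Set} (b : Bool) (p : A → Bool) (xs : List A) →
          count (λ x → b ∧ p x) xs ≡ (if b then count p xs else 0)
count-∧ true  p xs       = refl
count-∧ false p []       = refl
count-∧ false p (x ∷ xs) = count-∧ false p xs

length-filter≡count : {A : Set} {ℓ : Level} {P : Pred A ℓ} (P? : Decidable P) (p : A → Bool) →
                      (∀ {x} → P x ⇔ T (p x)) → ∀ xs → length (filter P? xs) ≡ count p xs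
length-filter≡count P? p P⇔p [] = refl
length-filter≡count P? p P⇔p (x ∷ xs) with p x in eq
... | true  = trans (cong length (filter-accept P? (from P⇔p (subst T (sym eq) tt))))
                    (cong suc (length-filter≡count P? p P⇔p xs))
... | false = trans (cong length (filter-reject P? (subst T eq ∘ to P⇔p)))
                    (length-filter≡count P? p P⇔p xs)

count-allSubsets-suc : ∀ {m} (p : Subset (suc m) → Bool) →
  count p (allSubsets (suc m)) ≡ count (p ∘ (true ∷_)) (allSubsets m) + count (p ∘ (false ∷_)) (allSubsets m)
count-allSubsets-suc {m} p = begin
  count p (map (true ∷_) S ++ map (false ∷_) S)
    ≡⟨ count-++ p (map (true ∷_) S) (map (false ∷_) S) ⟩
  count p (map (true ∷_) S) + count p (map (false ∷_) S)
    ≡⟨ cong₂ _+_ (count-map p (true ∷_) S) (count-map p (false ∷_) S) ⟩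
  count (p ∘ (true ∷_)) S + count (p ∘ (false ∷_)) S
    ∎
  where
  open ≡-Reasoning
  S : List (Subset m)
  S = allSubsets m

sumOverPairs : (Bool → Bool → ℕ) → ℕ
sumOverPairs f = f true true + f true false + f false true + f false false

sumOverPairs-cong : ∀ {f g} → (∀ a b → f a b ≡ g a b) → sumOverPairs f ≡ sumOverPairs g
sumOverPairs-cong f≡g =
  cong₂ _+_ (cong₂ _+_ (cong₂ _+_ (f≡g true true) (f≡g true false)) (f≡g false true)) (f≡g false false)

sumOverPairs-+ : ∀ f g → sumOverPairs (λ a b → f a b + g a b) ≡ sumOverPairs f + sumOverPairs g
sumOverPairs-+ f g = interchange (f true true) (g true true) (f true false) (g true false)
                                 (f false true) (g false true) (f false false) (g false false)
  where
  interchange : ∀ a a′ b b′ c c′ d d′ →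
    a + a′ + (b + b′) + (c + c′) + (d + d′) ≡ a + b + c + d + (a′ + b′ + c′ + d′)
  interchange = solve-∀

count-allSubsets-2+ : ∀ {m} (p : Subset (2 + m) → Bool) →
  count p (allSubsets (2 + m)) ≡ sumOverPairs (λ a b → count (λ x → p (a ∷ b ∷ x)) (allSubsets m))
count-allSubsets-2+ {m} p = begin
  count p (allSubsets (2 + m))
    ≡⟨ count-allSubsets-suc p ⟩
  count (p ∘ (true ∷_)) (allSubsets (suc m)) + count (p ∘ (false ∷_)) (allSubsets (suc m))
    ≡⟨ cong₂ _+_ (count-allSubsets-suc (p ∘ (true ∷_))) (count-allSubsets-suc (p ∘ (false ∷_))) ⟩
  c true true + c true false + (c false true + c false false)
    ≡⟨ +-assoc (c true true + c true false) (c false true) (c false false) ⟨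
  sumOverPairs c
    ∎
  where
  open ≡-Reasoning
  c : Bool → Bool → ℕ
  c a b = count (λ x → p (a ∷ b ∷ x)) (allSubsets m)

admissible : Bool → Bool → Bool → Bool
admissible a b c = (a ∨ b) ∧ not (a ∧ b ∧ c)

T-admissible : ∀ a b c → T (admissible a b c) ⇔ ((T a ⊎ T b) × ¬ (T a × T b × T c))
T-admissible true  true  true  = mk⇔ (λ ()) (λ (_ , ¬111) → ¬111 (tt , tt , tt))
T-admissible true  true  false = mk⇔ (λ _ → inj₁ tt , λ ()) (λ _ → tt)
T-admissible true  false _     = mk⇔ (λ _ → inj₁ tt , λ ()) (λ _ → tt)
T-admissible false true  _     = mk⇔ (λ _ → inj₂ tt , λ ()) (λ _ → tt)
T-admissible false false _     = mk⇔ (λ ()) (λ { (inj₁ () , _) ; (inj₂ () , _) })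

admissible-cong : ∀ {a a′ b b′ c c′} → a ≡ a′ → b ≡ b′ → c ≡ c′ → admissible a b c ≡ admissible a′ b′ c′
admissible-cong refl refl refl = refl

windowAt : (ℕ → Bool) → ℕ → Bool
windowAt f k = admissible (f k) (f (1 + k)) (f (2 + k))

admissibleWord : List Bool → Bool
admissibleWord (a ∷ b ∷ c ∷ w) = admissible a b c ∧ admissibleWord (b ∷ c ∷ w)
admissibleWord _               = true

admissibleWord-applyUpTo : ∀ (f : ℕ → Bool) m →
  T (admissibleWord (applyUpTo f (2 + m))) ⇔ (∀ i → i < m → T (windowAt f i))
admissibleWord-applyUpTo f zero    = mk⇔ (λ _ _ ()) (λ _ → tt)
admissibleWord-applyUpTo f (suc m) = mk⇔
  (λ t → λ { zero _ → proj₁ (to T-∧ t) ; (suc i) (s≤s i<m) → to ih (proj₂ (to T-∧ t)) i i<m })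
  (λ h → from T-∧ (h 0 (s≤s z≤n) , from ih (λ i i<m → h (suc i) (s≤s i<m))))
  where
  ih : T (admissibleWord (applyUpTo (f ∘ suc) (2 + m))) ⇔ (∀ i → i < m → T (windowAt (f ∘ suc) i))
  ih = admissibleWord-applyUpTo (f ∘ suc) m

applyUpTo-+ : ∀ {A : Set} (f : ℕ → A) m k → applyUpTo f (m + k) ≡ applyUpTo f m ++ applyUpTo (f ∘ (m +_)) k
applyUpTo-+ f zero    k = refl
applyUpTo-+ f (suc m) k = cong (f 0 ∷_) (applyUpTo-+ (f ∘ suc) m k)

applyUpTo-lookup : ∀ {A : Set} {m} (xs : Vec A m) (f : ℕ → A) →
                   (∀ i → f (toℕ i) ≡ lookup xs i) → applyUpTo f m ≡ toList xs
applyUpTo-lookup []       f h = refl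
applyUpTo-lookup (x ∷ xs) f h = cong₂ _∷_ (h fzero) (applyUpTo-lookup xs (f ∘ suc) (h ∘ fsuc))

-- The cyclic word of F followed by its first two letters again: the windows of this list are
-- exactly the cyclic windows of F.
cyclicWord : ∀ {m} → Vec Bool (2 + m) → List Bool
cyclicWord (a ∷ b ∷ w) = a ∷ b ∷ toList w ++ a ∷ b ∷ []

admissibleCyclic : ∀ {m} → Vec Bool (2 + m) → Bool
admissibleCyclic = admissibleWord ∘ cyclicWord

completions : Bool → Bool → ℕ → Bool → Bool → ℕ
completions a b m c d = count (λ w → admissibleWord (a ∷ b ∷ toList w ++ c ∷ d ∷ [])) (allSubsets m)

-- Transfer-matrix recursion on the last two letters: after 11 only 0 may follow, after 10 only 1,
-- and 00 never occurs.
transfer : Bool → Bool → ℕ → Bool → Bool → ℕ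
transfer a     b     zero    c d = if admissibleWord (a ∷ b ∷ c ∷ d ∷ []) then 1 else 0
transfer true  true  (suc m) c d = transfer true false m c d
transfer true  false (suc m) c d = transfer false true m c d
transfer false true  (suc m) c d = transfer true true m c d + transfer true false m c d
transfer false false (suc m) c d = 0

transfer-00 : ∀ m c d → transfer false false m c d ≡ 0
transfer-00 zero    c d = refl
transfer-00 (suc m) c d = refl

completions-suc : ∀ a b m c d → completions a b (suc m) c d ≡
  (if admissible a b true then completions b true m c d else 0) +
  (if admissible a b false then completions b false m c d else 0)
completions-suc a b m c d = trans (count-allSubsets-suc {m} _)
  (cong₂ _+_ (count-∧ (admissible a b true) _ (allSubsets m)) (count-∧ (admissible a b false) _ (allSubsets m)))

completions≡transfer : ∀ a b m c d → completions a b m c d ≡ transfer a b m c d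
completions≡transfer a b zero c d = refl
completions≡transfer true true (suc m) c d =
  trans (completions-suc true true m c d) (completions≡transfer true false m c d)
completions≡transfer true false (suc m) c d =
  trans (completions-suc true false m c d)
        (trans (cong₂ _+_ (completions≡transfer false true m c d)
                          (trans (completions≡transfer false false m c d) (transfer-00 m c d)))
               (+-identityʳ _))
completions≡transfer false true (suc m) c d =
  trans (completions-suc false true m c d)
        (cong₂ _+_ (completions≡transfer true true m c d) (completions≡transfer true false m c d))
completions≡transfer false false (suc m) c d = completions-suc false false m c d

transfer-rec : ∀ a b m c d → transfer a b (3 + m) c d ≡ transfer a b (1 + m) c d + transfer a b m c d
transfer-rec true  true  m c d = +-comm (transfer true true m c d) (transfer true false m c d)
transfer-rec true  false m c d = +-comm (transfer true false m c d) (transfer false true m c d)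
transfer-rec false true  m c d = +-comm (transfer false true m c d) _
transfer-rec false false m c d = sym (transfer-00 m c d)

cyclicCount : ℕ → ℕ
cyclicCount m = sumOverPairs (λ a b → transfer a b m a b)

cyclicCount-rec : ∀ m → cyclicCount (3 + m) ≡ cyclicCount (1 + m) + cyclicCount m
cyclicCount-rec m = trans (sumOverPairs-cong (λ a b → transfer-rec a b m a b))
                          (sumOverPairs-+ (λ a b → transfer a b (1 + m) a b) (λ a b → transfer a b m a b))

count-admissibleCyclic : ∀ m → count admissibleCyclic (allSubsets (2 + m)) ≡ cyclicCount m
count-admissibleCyclic m = trans (count-allSubsets-2+ {m} admissibleCyclic)
                                 (sumOverPairs-cong (λ a b → completions≡transfer a b m a b))

∈⇔T-lookup : ∀ {m} {F : Subset m} {v} → v ∈ F ⇔ T (lookup F v)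
∈⇔T-lookup {F = F} {v} = mk⇔ (from T-≡ ∘ []=⇒lookup) (lookup⇒[]= v F ∘ to T-≡)

∈-nbhd⇔ : ∀ {m} (G : Graph m) v {w} → w ∈ nbhd G v ⇔ T (G v w)
∈-nbhd⇔ G v {w} = subst (λ b → w ∈ nbhd G v ⇔ T b) (lookup∘tabulate (G v) w) ∈⇔T-lookup

module _ {m} {S : Subset m} {a b : Fin m} (S-pair : ∀ {w} → w ∈ S ⇔ (w ≡ a ⊎ w ≡ b)) {F : Subset m} where

  ⁅a⁆⊆S∩F : a ∈ F → ⁅ a ⁆ ⊆ S ∩ F
  ⁅a⁆⊆S∩F a∈F w∈⁅a⁆ with x∈⁅y⁆⇒x≡y a w∈⁅a⁆
  ... | refl = x∈p∩q⁺ (from S-pair (inj₁ refl) , a∈F)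

  ∣pair∩p∣≡1 : a ∈ F → b ∉ F → ∣ S ∩ F ∣ ≡ 1
  ∣pair∩p∣≡1 a∈F b∉F = trans (cong ∣_∣ (⊆-antisym S∩F⊆⁅a⁆ (⁅a⁆⊆S∩F a∈F))) (∣⁅x⁆∣≡1 a)
    where
    S∩F⊆⁅a⁆ : S ∩ F ⊆ ⁅ a ⁆
    S∩F⊆⁅a⁆ w∈S∩F with x∈p∩q⁻ S F w∈S∩F
    ... | w∈S , w∈F with to S-pair w∈S
    ...   | inj₁ refl = x∈⁅x⁆ a
    ...   | inj₂ refl = ⊥-elim (b∉F w∈F)

  ∣pair∩p∣>1 : a ≢ b → a ∈ F → b ∈ F → ∣ S ∩ F ∣ > 1
  ∣pair∩p∣>1 a≢b a∈F b∈F = subst (_< ∣ S ∩ F ∣) (∣⁅x⁆∣≡1 a)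
    (p⊂q⇒∣p∣<∣q∣ (⁅a⁆⊆S∩F a∈F , b , x∈p∩q⁺ (from S-pair (inj₂ refl) , b∈F) , b∉⁅a⁆))
    where
    b∉⁅a⁆ : b ∉ ⁅ a ⁆
    b∉⁅a⁆ b∈⁅a⁆ = a≢b (sym (x∈⁅y⁆⇒x≡y a b∈⁅a⁆))

∨-shuffle : ∀ a b c d → a ∨ (b ∨ (c ∨ d)) ≡ (a ∨ d) ∨ (b ∨ c)
∨-shuffle true  b     c d     = refl
∨-shuffle false true  c true  = refl
∨-shuffle false false c true  = ∨-zeroʳ c
∨-shuffle false b     c false = cong (b ∨_) (∨-identityʳ c)

m+n*[1+o]≡m+n+n*o : ∀ m n o → m + n * suc o ≡ m + n + n * o
m+n*[1+o]≡m+n+n*o = solve-∀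

m+n*o+n≡m+n*[1+o] : ∀ m n o → m + n * o + n ≡ m + n * suc o
m+n*o+n≡m+n*[1+o] = solve-∀

module Cycle (K : ℕ) where

  n : ℕ
  n = 3 + K

  C : Graph n
  C = cycleGraph n

  -- Subsets of the cycle are read as periodic words: position k of the word is vertex k.
  vertex : ℕ → Fin n
  vertex k = k mod n

  toℕ-vertex : ∀ k → toℕ (vertex k) ≡ k % n
  toℕ-vertex k = toℕ-fromℕ< (m%n<n k n)

  %≡⇒vertex≡ : ∀ a b → a % n ≡ b % n → vertex a ≡ vertex b
  %≡⇒vertex≡ a b e = toℕ-injective (trans (toℕ-vertex a) (trans e (sym (toℕ-vertex b))))

  vertex≡⇒%≡ : ∀ a b → vertex a ≡ vertex b → a % n ≡ b % n
  vertex≡⇒%≡ a b e = trans (sym (toℕ-vertex a)) (trans (cong toℕ e) (toℕ-vertex b))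

  vertex-toℕ : ∀ v → vertex (toℕ v) ≡ v
  vertex-toℕ v = toℕ-injective (trans (toℕ-vertex (toℕ v)) (m<n⇒m%n≡m (toℕ<n v)))

  vertex-% : ∀ k → vertex (k % n) ≡ vertex k
  vertex-% k = %≡⇒vertex≡ (k % n) k (m%n%n≡m%n k n)

  vertex-+-cong : ∀ a b c d → vertex a ≡ vertex b → vertex c ≡ vertex d → vertex (a + c) ≡ vertex (b + d)
  vertex-+-cong a b c d a≡b c≡d = %≡⇒vertex≡ (a + c) (b + d) (begin
    (a + c) % n          ≡⟨ %-distribˡ-+ a c n ⟩
    (a % n + c % n) % n  ≡⟨ cong₂ (λ x y → (x + y) % n) (vertex≡⇒%≡ a b a≡b) (vertex≡⇒%≡ c d c≡d) ⟩
    (b % n + d % n) % n  ≡⟨ %-distribˡ-+ b d n ⟨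
    (b + d) % n          ∎)
    where open ≡-Reasoning

  vertex-+-congˡ : ∀ c a b → vertex a ≡ vertex b → vertex (c + a) ≡ vertex (c + b)
  vertex-+-congˡ c a b = vertex-+-cong c c a b refl

  vertex-+-congʳ : ∀ c a b → vertex a ≡ vertex b → vertex (a + c) ≡ vertex (b + c)
  vertex-+-congʳ c a b a≡b = vertex-+-cong a b c c a≡b refl

  vertex-periodic : ∀ a k → vertex (a + k * n) ≡ vertex a
  vertex-periodic a k = %≡⇒vertex≡ (a + k * n) a ([m+kn]%n≡m%n a k n)

  vertex-n+ : ∀ a → vertex (n + a) ≡ vertex a
  vertex-n+ a = vertex-+-congʳ a n 0 (%≡⇒vertex≡ n 0 (n%n≡0 n))

  vertex-+-cancelʳ : ∀ a b c → vertex (a + c) ≡ vertex (b + c) → vertex a ≡ vertex b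
  vertex-+-cancelʳ a b c e = begin
    vertex a                     ≡⟨ vertex-periodic a c ⟨
    vertex (a + c * n)           ≡⟨ cong vertex (m+n*[1+o]≡m+n+n*o a c (2 + K)) ⟩
    vertex (a + c + c * (2 + K)) ≡⟨ vertex-+-congʳ (c * (2 + K)) (a + c) (b + c) e ⟩
    vertex (b + c + c * (2 + K)) ≡⟨ cong vertex (m+n*[1+o]≡m+n+n*o b c (2 + K)) ⟨
    vertex (b + c * n)           ≡⟨ vertex-periodic b c ⟩
    vertex b                     ∎
    where open ≡-Reasoning

  vertex-suc-injective : ∀ a b → vertex (suc a) ≡ vertex (suc b) → vertex a ≡ vertex b
  vertex-suc-injective a b e =
    vertex-+-cancelʳ a b 1 (trans (cong vertex (+-comm a 1)) (trans e (cong vertex (+-comm 1 b))))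

  vertex-suc-≢ : ∀ a → vertex (suc a) ≢ vertex a
  vertex-suc-≢ a e with vertex-+-cancelʳ 1 0 a e
  ... | ()

  vertex-2+-≢ : ∀ a → vertex (2 + a) ≢ vertex a
  vertex-2+-≢ a e with vertex-+-cancelʳ 2 0 a e
  ... | ()

  vertex-onto : ∀ v k → ∃ λ j → vertex (j + k) ≡ v
  vertex-onto v k = toℕ v + k * (2 + K) , (begin
    vertex (toℕ v + k * (2 + K) + k) ≡⟨ cong vertex (m+n*o+n≡m+n*[1+o] (toℕ v) k (2 + K)) ⟩
    vertex (toℕ v + k * n)           ≡⟨ vertex-periodic (toℕ v) k ⟩
    vertex (toℕ v)                   ≡⟨ vertex-toℕ v ⟩
    v                                ∎)
    where open ≡-Reasoning

  vertex-suc-onto : ∀ v → ∃ λ k → vertex (suc k) ≡ v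
  vertex-suc-onto v with vertex-onto v 1
  ... | j , e = j , trans (cong vertex (+-comm 1 j)) e

  next : Fin n → Fin n
  next v = vertex (suc (toℕ v))

  next-vertex : ∀ k → next (vertex k) ≡ vertex (suc k)
  next-vertex k = vertex-+-congˡ 1 (toℕ (vertex k)) k (vertex-toℕ (vertex k))

  next≡vertex-suc : ∀ w k → next w ≡ vertex (suc k) → w ≡ vertex k
  next≡vertex-suc w k e = trans (sym (vertex-toℕ w)) (vertex-suc-injective (toℕ w) k e)

  -- cycleGraph n i j is a disjunction of four tests; follows i j collects the two saying that
  -- j comes right after i on the cycle.
  follows : ℕ → ℕ → Bool
  follows i j = (suc i ≡ᵇ j) ∨ ((j ≡ᵇ 0) ∧ (suc i ≡ᵇ n))

  follows⇔ : ∀ {i j} → i < n → j < n → T (follows i j) ⇔ suc i % n ≡ j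
  follows⇔ {i} {j} i<n j<n = mk⇔ ⇒ ⇐
    where
    ⇒ : T (follows i j) → suc i % n ≡ j
    ⇒ t with to T-∨ t
    ... | inj₁ 1+i≡j = trans (cong (_% n) (≡ᵇ⇒≡ (suc i) j 1+i≡j)) (m<n⇒m%n≡m j<n)
    ... | inj₂ wraps with to T-∧ wraps
    ...   | j≡0 , 1+i≡n = trans (cong (_% n) (≡ᵇ⇒≡ (suc i) n 1+i≡n)) (trans (n%n≡0 n) (sym (≡ᵇ⇒≡ j 0 j≡0)))
    ⇐ : suc i % n ≡ j → T (follows i j)
    ⇐ e with m≤n⇒m<n∨m≡n i<n
    ... | inj₁ 1+i<n = from T-∨ (inj₁ (≡⇒≡ᵇ (suc i) j (trans (sym (m<n⇒m%n≡m 1+i<n)) e)))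
    ... | inj₂ 1+i≡n = from T-∨ (inj₂ (from T-∧ (≡⇒≡ᵇ j 0 j≡0 , ≡⇒≡ᵇ (suc i) n 1+i≡n)))
      where
      j≡0 : j ≡ 0
      j≡0 = trans (sym e) (trans (cong (_% n) 1+i≡n) (n%n≡0 n))

  follows⇔next : ∀ v w → T (follows (toℕ v) (toℕ w)) ⇔ next v ≡ w
  follows⇔next v w = ⇔-trans (follows⇔ (toℕ<n v) (toℕ<n w))
    (mk⇔ (λ e → toℕ-injective (trans (toℕ-vertex (suc (toℕ v))) e))
         (λ e → trans (sym (toℕ-vertex (suc (toℕ v)))) (cong toℕ e)))

  C≡follows : ∀ v w → C v w ≡ follows (toℕ v) (toℕ w) ∨ follows (toℕ w) (toℕ v)
  C≡follows v w = ∨-shuffle (suc i ≡ᵇ j) (suc j ≡ᵇ i) ((i ≡ᵇ 0) ∧ (suc j ≡ᵇ n)) ((j ≡ᵇ 0) ∧ (suc i ≡ᵇ n))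
    where
    i j : ℕ
    i = toℕ v
    j = toℕ w

  adjacent⇔ : ∀ v w → T (C v w) ⇔ (next v ≡ w ⊎ next w ≡ v)
  adjacent⇔ v w = subst (λ b → T b ⇔ (next v ≡ w ⊎ next w ≡ v)) (sym (C≡follows v w))
    (⇔-trans T-∨ (follows⇔next v w ⊎-⇔ follows⇔next w v))

  ∈-nbhd-vertex : ∀ k {w} → w ∈ nbhd C (vertex (suc k)) ⇔ (w ≡ vertex (2 + k) ⊎ w ≡ vertex k)
  ∈-nbhd-vertex k {w} = ⇔-trans (∈-nbhd⇔ C (vertex (suc k))) (⇔-trans (adjacent⇔ (vertex (suc k)) w) (mk⇔
    (Sum.map (λ e → trans (sym e) (next-vertex (suc k))) (next≡vertex-suc w k))
    (Sum.map (λ e → trans (next-vertex (suc k)) (sym e)) (λ { refl → next-vertex k }))))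

  NoGap : Subset n → Set
  NoGap F = ∀ k → vertex k ∈ F ⊎ vertex (suc k) ∈ F

  NoTriple : Subset n → Set
  NoTriple F = ∀ k → ¬ (vertex k ∈ F × vertex (1 + k) ∈ F × vertex (2 + k) ∈ F)

  gap-propagates : ∀ {F} k → IsFort C F → vertex k ∉ F → vertex (suc k) ∉ F → vertex (2 + k) ∉ F
  gap-propagates k (_ , fort) k∉F 1+k∉F 2+k∈F =
    fort (vertex (suc k)) 1+k∉F (∣pair∩p∣≡1 (∈-nbhd-vertex k) 2+k∈F k∉F)

  fort⇒noGap : ∀ {F} → IsFort C F → NoGap F
  fort⇒noGap {F} fort@((x , x∈F) , _) k with vertex k ∈? F | vertex (suc k) ∈? F
  ... | yes k∈F | _         = inj₁ k∈F
  ... | no _    | yes 1+k∈F = inj₂ 1+k∈F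
  ... | no k∉F  | no 1+k∉F with vertex-onto x k
  ...   | j , j+k≡x = ⊥-elim (proj₁ (gap j) (subst (_∈ F) (sym j+k≡x) x∈F))
    where
    gap : ∀ j → vertex (j + k) ∉ F × vertex (suc j + k) ∉ F
    gap zero    = k∉F , 1+k∉F
    gap (suc j) = proj₂ (gap j) , gap-propagates (j + k) fort (proj₁ (gap j)) (proj₂ (gap j))

  noGap⇒fort : ∀ {F} → NoGap F → IsFort C F
  noGap⇒fort {F} noGap = Sum.[ (vertex 0 ,_) , (vertex 1 ,_) ]′ (noGap 0) , outside-sees-two
    where
    outside-sees-two : ∀ v → v ∉ F → ∣ nbhd C v ∩ F ∣ ≢ 1
    outside-sees-two v v∉F with vertex-suc-onto v
    ... | k , refl = >⇒≢ (∣pair∩p∣>1 (∈-nbhd-vertex k) (vertex-2+-≢ k) 2+k∈F k∈F)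
      where
      k∈F : vertex k ∈ F
      k∈F = Sum.[ id , ⊥-elim ∘ v∉F ]′ (noGap k)
      2+k∈F : vertex (2 + k) ∈ F
      2+k∈F = Sum.[ ⊥-elim ∘ v∉F , id ]′ (noGap (suc k))

  noGap-remove : ∀ {F} k → NoGap F → vertex k ∈ F → vertex (2 + k) ∈ F → NoGap (F - vertex (suc k))
  noGap-remove {F} k noGap k∈F 2+k∈F j with noGap j
  ... | inj₁ j∈F with vertex j ≟ᶠ vertex (suc k)
  ...   | no j≢ = inj₁ (x∈p∧x≢y⇒x∈p-y j∈F j≢)
  ...   | yes j≡ = inj₂ (x∈p∧x≢y⇒x∈p-y (subst (_∈ F) (sym 1+j≡) 2+k∈F)
                                        (λ e → vertex-suc-≢ j (trans e (sym j≡))))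
    where
    1+j≡ : vertex (suc j) ≡ vertex (2 + k)
    1+j≡ = vertex-+-congˡ 1 j (suc k) j≡
  noGap-remove {F} k noGap k∈F 2+k∈F j | inj₂ 1+j∈F with vertex (suc j) ≟ᶠ vertex (suc k)
  ...   | no 1+j≢ = inj₂ (x∈p∧x≢y⇒x∈p-y 1+j∈F 1+j≢)
  ...   | yes 1+j≡ = inj₁ (x∈p∧x≢y⇒x∈p-y (subst (_∈ F) (sym (vertex-suc-injective j k 1+j≡)) k∈F)
                                          (λ e → vertex-suc-≢ j (trans 1+j≡ (sym e))))

  minimalFort⇒noTriple : ∀ {F} → IsMinimalFort C F → NoTriple F
  minimalFort⇒noTriple {F} (fort , minimal) k (k∈F , 1+k∈F , 2+k∈F) =
    minimal (F - vertex (suc k)) (x∈p⇒p-x⊂p 1+k∈F) (noGap⇒fort (noGap-remove k (fort⇒noGap fort) k∈F 2+k∈F))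

  noGap-noTriple⇒minimalFort : ∀ {F} → NoGap F → NoTriple F → IsMinimalFort C F
  noGap-noTriple⇒minimalFort {F} noGap noTriple = noGap⇒fort noGap , minimal
    where
    minimal : ∀ F′ → F′ ⊂ F → ¬ IsFort C F′
    minimal F′ (F′⊆F , x , x∈F , x∉F′) fort′ with vertex-suc-onto x
    ... | k , refl with vertex k ∈? F | vertex (2 + k) ∈? F
    ...   | yes k∈F | yes 2+k∈F = noTriple k (k∈F , x∈F , 2+k∈F)
    ...   | no k∉F  | _         = Sum.[ k∉F ∘ F′⊆F , x∉F′ ]′ (fort⇒noGap fort′ k)
    ...   | yes _   | no 2+k∉F  = Sum.[ x∉F′ , 2+k∉F ∘ F′⊆F ]′ (fort⇒noGap fort′ (suc k))

  minimalFort⇔noGap×noTriple : ∀ F → IsMinimalFort C F ⇔ (NoGap F × NoTriple F)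
  minimalFort⇔noGap×noTriple F = mk⇔
    (λ minimalFort → fort⇒noGap (proj₁ minimalFort) , minimalFort⇒noTriple minimalFort)
    (λ (noGap , noTriple) → noGap-noTriple⇒minimalFort noGap noTriple)

  at : Subset n → ℕ → Bool
  at F k = lookup F (vertex k)

  noGap×noTriple⇔windows : ∀ F → (NoGap F × NoTriple F) ⇔ (∀ k → T (windowAt (at F) k))
  noGap×noTriple⇔windows F = mk⇔
    (λ (noGap , noTriple) k → from (window⇔ k)
      (Sum.map ∈⇒T ∈⇒T (noGap k) , λ (t₀ , t₁ , t₂) → noTriple k (T⇒∈ t₀ , T⇒∈ t₁ , T⇒∈ t₂)))
    (λ windows →
        (λ k → Sum.map T⇒∈ T⇒∈ (proj₁ (to (window⇔ k) (windows k))))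
      , (λ k (k∈F , 1+k∈F , 2+k∈F) → proj₂ (to (window⇔ k) (windows k)) (∈⇒T k∈F , ∈⇒T 1+k∈F , ∈⇒T 2+k∈F)))
    where
    ∈⇒T : ∀ {v} → v ∈ F → T (lookup F v)
    ∈⇒T = to ∈⇔T-lookup
    T⇒∈ : ∀ {v} → T (lookup F v) → v ∈ F
    T⇒∈ = from ∈⇔T-lookup
    window⇔ : ∀ k → T (windowAt (at F) k) ⇔
      ((T (at F k) ⊎ T (at F (1 + k))) × ¬ (T (at F k) × T (at F (1 + k)) × T (at F (2 + k))))
    window⇔ k = T-admissible (at F k) (at F (1 + k)) (at F (2 + k))

  windows⇔windows<n : ∀ F → (∀ k → T (windowAt (at F) k)) ⇔ (∀ k → k < n → T (windowAt (at F) k))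
  windows⇔windows<n F = mk⇔ (λ h k _ → h k) (λ h k → subst T (windowAt-% k) (h (k % n) (m%n<n k n)))
    where
    at-% : ∀ k j → at F (j + k % n) ≡ at F (j + k)
    at-% k j = cong (lookup F) (vertex-+-congˡ j (k % n) k (vertex-% k))
    windowAt-% : ∀ k → windowAt (at F) (k % n) ≡ windowAt (at F) k
    windowAt-% k = admissible-cong (at-% k 0) (at-% k 1) (at-% k 2)

  applyUpTo-at : ∀ F → applyUpTo (at F) (2 + n) ≡ cyclicWord F
  applyUpTo-at F@(a ∷ b ∷ _) = begin
    applyUpTo (at F) (2 + n)
      ≡⟨ cong (applyUpTo (at F)) (+-comm 2 n) ⟩
    applyUpTo (at F) (n + 2)
      ≡⟨ applyUpTo-+ (at F) n 2 ⟩
    applyUpTo (at F) n ++ at F (n + 0) ∷ at F (n + 1) ∷ []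
      ≡⟨ cong₂ _++_ (applyUpTo-lookup F (at F) (cong (lookup F) ∘ vertex-toℕ))
                    (cong₂ (λ x y → x ∷ y ∷ []) (at-n+ 0) (at-n+ 1)) ⟩
    toList F ++ a ∷ b ∷ []
      ∎
    where
    open ≡-Reasoning
    at-n+ : ∀ j → at F (n + j) ≡ at F j
    at-n+ j = cong (lookup F) (vertex-n+ j)

  minimalFort⇔admissibleCyclic : ∀ {F} → IsMinimalFort C F ⇔ T (admissibleCyclic F)
  minimalFort⇔admissibleCyclic {F} =
    ⇔-trans (minimalFort⇔noGap×noTriple F)
    (⇔-trans (noGap×noTriple⇔windows F)
    (⇔-trans (windows⇔windows<n F)
    (subst (λ w → (∀ k → k < n → T (windowAt (at F) k)) ⇔ T (admissibleWord w)) (applyUpTo-at F)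
           (⇔-sym (admissibleWord-applyUpTo (at F) n)))))

  numMinimalForts≡cyclicCount : numMinimalForts C ≡ cyclicCount (suc K)
  numMinimalForts≡cyclicCount =
    trans (length-filter≡count (isMinimalFort? C) admissibleCyclic minimalFort⇔admissibleCyclic (allSubsets n))
          (count-admissibleCyclic (suc K))

-- The size is passed through an equation: comparing numMinimalForts at two different spellings of
-- the same size makes Agda unfold the brute-force count.
numMinimalForts-cycleGraph : ∀ {n} K → n ≡ 3 + K → numMinimalForts (cycleGraph n) ≡ cyclicCount (suc K)
numMinimalForts-cycleGraph K refl = Cycle.numMinimalForts≡cyclicCount K

recurrence : ∀ n → 6 ≤ n →
  numMinimalForts (cycleGraph n) ≡ numMinimalForts (cycleGraph (n ∸ 2)) + numMinimalForts (cycleGraph (n ∸ 3))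
recurrence n 6≤n with m≤n⇒∃[o]m+o≡n 6≤n
... | k , 6+k≡n = begin
  numMinimalForts (cycleGraph n)
    ≡⟨ numMinimalForts-cycleGraph {n} (3 + k) (sym 6+k≡n) ⟩
  cyclicCount (4 + k)
    ≡⟨ cyclicCount-rec (1 + k) ⟩
  cyclicCount (2 + k) + cyclicCount (1 + k)
    ≡⟨ cong₂ _+_ (numMinimalForts-cycleGraph {n ∸ 2} (1 + k) (cong (_∸ 2) (sym 6+k≡n)))
                 (numMinimalForts-cycleGraph {n ∸ 3} k (cong (_∸ 3) (sym 6+k≡n))) ⟨
  numMinimalForts (cycleGraph (n ∸ 2)) + numMinimalForts (cycleGraph (n ∸ 3))
    ∎
  where open ≡-Reasoning

corollary4p5 :
    ((n : ℕ) → 6 ≤ n →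
      numMinimalForts (cycleGraph n)
        ≡ numMinimalForts (cycleGraph (n ∸ 2)) + numMinimalForts (cycleGraph (n ∸ 3)))
    × numMinimalForts (cycleGraph 3) ≡ 3
    × numMinimalForts (cycleGraph 4) ≡ 2
    × numMinimalForts (cycleGraph 5) ≡ 5
corollary4p5 = recurrence
             , numMinimalForts-cycleGraph {3} 0 refl
             , numMinimalForts-cycleGraph {4} 1 refl
             , numMinimalForts-cycleGraph {5} 2 refl
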